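{- The canonical structure $\mathbb{M}=(\mathbb{P},V)$, where $V(p)=(\mathrm{val}(p),\mathrm{descr}(p))$ with $\mathrm{val}(p)(f)=f(p)$ for $f\in\mathsf{F}_{\mathbf{A}}(\mathbf{Fm})$ and $\mathrm{descr}(p)(i)=i(p)$ for $i\in\mathsf{I}_{\mathbf{A}}(\mathbf{Fm})$, is a polarity-based $\mathbf{A}$-model; i.e., for every atomic proposition $p$, $\mathrm{val}(p)^{\uparrow}=\mathrm{descr}(p)$ and $\mathrm{descr}(p)^{\downarrow}=\mathrm{val}(p)$.
   Context: $\mathbf{A}=(D,1,0,\vee,\wedge,\otimes,\to)$ is a fixed complete, frame-distributive and dually frame-distributive, commutative and associative residuated lattice with $1\to\alpha=\alpha$. $\mathbf{Fm}$ is the Lindenbaum–Tarski algebra of formulas of the language $\varphi ::= \bot \mid \top \mid p \mid \varphi\wedge\varphi \mid \varphi\vee\varphi \mid \Box\varphi \mid \Diamond\varphi$ modulo the basic normal non-distributive modal logic $\mathbf{L}$. A proper $\mathbf{A}$-filter is $f:\mathbf{Fm}\to\mathbf{A}$ with $f(\top)=1$, $f(\bot)=0$, $f(a\wedge b)=f(a)\wedge f(b)$; a proper $\mathbf{A}$-ideal is $i:\mathbf{Fm}\to\mathbf{A}$ with $i(\bot)=1$, $i(\top)=0$, $i(a\vee b)=i(a)\wedge i(b)$; $\mathsf{F}_{\mathbf{A}}(\mathbf{Fm})$, $\mathsf{I}_{\mathbf{A}}(\mathbf{Fm})$ are the sets of these. The canonical frame $\mathbb{P}=(\mathsf{F}_{\mathbf{A}}(\mathbf{Fm}),\mathsf{I}_{\mathbf{A}}(\mathbf{Fm}),I,R_\Diamond,R_\Box)$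 has $I(f,i)=\bigvee_{\phi\in\mathbf{Fm}}(f(\phi)\otimes i(\phi))$, $R_\Diamond(i,f)=\bigvee_{\phi}(f(\phi)\otimes i(\Diamond\phi))$, $R_\Box(f,i)=\bigvee_\phi(f(\Box\phi)\otimes i(\phi))$. For $g:\mathsf{F}_{\mathbf{A}}(\mathbf{Fm})\to\mathbf{A}$, $g^\uparrow(i)=\bigwedge_{f}(g(f)\to I(f,i))$; for $u:\mathsf{I}_{\mathbf{A}}(\mathbf{Fm})\to\mathbf{A}$, $u^\downarrow(f)=\bigwedge_{i}(u(i)\to I(f,i))$. -}

module Defs where

open import Level using (0ℓ)
open import Data.Product using (Σ; _×_; _,_; proj₁; proj₂)
open import Relation.Binary.PropositionalEquality using (_≡_)

record CRL : Set₁ where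
  infix  4 _≤_
  infixr 6 _∨_
  infixr 7 _∧_
  infixr 8 _⊗_
  infixr 5 _⇒_
  field
    D    : Set
    _≤_  : D → D → Set
    ≤-refl    : ∀ {a} → a ≤ a
    ≤-trans   : ∀ {a b c} → a ≤ b → b ≤ c → a ≤ c
    ≤-antisym : ∀ {a b} → a ≤ b → b ≤ a → a ≡ b

    𝟙 𝟘 : D
    𝟙-top : ∀ a → a ≤ 𝟙
    𝟘-bot : ∀ a → 𝟘 ≤ a

    _∨_ _∧_ : D → D → D
    ∨-inl : ∀ a b → a ≤ a ∨ b
    ∨-inr : ∀ a b → b ≤ a ∨ b
    ∨-lub : ∀ {a b c} → a ≤ c → b ≤ c → a ∨ b ≤ c
    ∧-fst : ∀ a b → a ∧ b ≤ a
    ∧-snd : ∀ a b → a ∧ b ≤ b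
    ∧-glb : ∀ {a b c} → c ≤ a → c ≤ b → c ≤ a ∧ b

    ⋁ ⋀ : {I : Set} → (I → D) → D
    ⋁-ub  : ∀ {I : Set} (g : I → D) (k : I) → g k ≤ ⋁ g
    ⋁-lub : ∀ {I : Set} (g : I → D) {c} → (∀ k → g k ≤ c) → ⋁ g ≤ c
    ⋀-lb  : ∀ {I : Set} (g : I → D) (k : I) → ⋀ g ≤ g k
    ⋀-glb : ∀ {I : Set} (g : I → D) {c} → (∀ k → c ≤ g k) → c ≤ ⋀ g

    frame-distrib  : ∀ {I : Set} a (g : I → D) → a ∧ ⋁ g ≡ ⋁ (λ k → a ∧ g k)
    dframe-distrib : ∀ {I : Set} a (g : I → D) → a ∨ ⋀ g ≡ ⋀ (λ k → a ∨ g k)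

    _⊗_ _⇒_ : D → D → D
    ⊗-assoc  : ∀ a b c → (a ⊗ b) ⊗ c ≡ a ⊗ (b ⊗ c)
    ⊗-comm   : ∀ a b → a ⊗ b ≡ b ⊗ a
    ⊗-unitˡ  : ∀ a → 𝟙 ⊗ a ≡ a
    residual₁ : ∀ {a b c} → a ⊗ b ≤ c → b ≤ a ⇒ c
    residual₂ : ∀ {a b c} → b ≤ a ⇒ c → a ⊗ b ≤ c

    𝟙⇒ : ∀ a → 𝟙 ⇒ a ≡ a

data Fm (Atom : Set) : Set where
  ⊥′ ⊤′ : Fm Atom
  var   : Atom → Fm Atom
  _∧′_ _∨′_ : Fm Atom → Fm Atom → Fm Atom
  □′ ◇′ : Fm Atom → Fm Atom

infix 3 _⊢_
data _⊢_ {Atom : Set} : Fm Atom → Fm Atom → Set where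
  id⊢   : ∀ {φ} → φ ⊢ φ
  cut   : ∀ {φ ψ χ} → φ ⊢ ψ → ψ ⊢ χ → φ ⊢ χ
  ⊥⊢    : ∀ {φ} → ⊥′ ⊢ φ
  ⊢⊤    : ∀ {φ} → φ ⊢ ⊤′
  ∧⊢₁   : ∀ {φ ψ} → φ ∧′ ψ ⊢ φ
  ∧⊢₂   : ∀ {φ ψ} → φ ∧′ ψ ⊢ ψ
  ⊢∧    : ∀ {φ ψ χ} → χ ⊢ φ → χ ⊢ ψ → χ ⊢ φ ∧′ ψ
  ⊢∨₁   : ∀ {φ ψ} → φ ⊢ φ ∨′ ψ
  ⊢∨₂   : ∀ {φ ψ} → ψ ⊢ φ ∨′ ψ
  ∨⊢    : ∀ {φ ψ χ} → φ ⊢ χ → ψ ⊢ χ → φ ∨′ ψ ⊢ χ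
  ⊤⊢□⊤  : ⊤′ ⊢ □′ ⊤′
  ◇⊥⊢⊥  : ◇′ ⊥′ ⊢ ⊥′
  □∧    : ∀ {φ ψ} → □′ φ ∧′ □′ ψ ⊢ □′ (φ ∧′ ψ)
  ◇∨    : ∀ {φ ψ} → ◇′ (φ ∨′ ψ) ⊢ ◇′ φ ∨′ ◇′ ψ
  □mono : ∀ {φ ψ} → φ ⊢ ψ → □′ φ ⊢ □′ ψ
  ◇mono : ∀ {φ ψ} → φ ⊢ ψ → ◇′ φ ⊢ ◇′ ψ

module _ (𝐀 : CRL) where
  open CRL 𝐀

  record APolarity : Set₁ where
    field
      X Y : Set
      I   : X → Y → D
      R◇  : Y → X → D
      R□  : X → Y → D

  module _ (P : APolarity) where
    open APolarity P

    _↑ : (X → D) → (Y → D)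
    (g ↑) y = ⋀ (λ x → g x ⇒ I x y)

    _↓ : (Y → D) → (X → D)
    (u ↓) x = ⋀ (λ y → u y ⇒ I x y)

    IsAModel : {Atom : Set} → (Atom → X → D) → (Atom → Y → D) → Set
    IsAModel val descr =
      ∀ p → (∀ y → (val p ↑) y ≡ descr p y) × (∀ x → (descr p ↓) x ≡ val p x)

  -- Canonical frame.  Fm modulo L is represented by formulas together
  -- with the requirement that maps respect L-interderivability.

  module _ (Atom : Set) where

    record AFilter : Set where
      field
        fun  : Fm Atom → D
        resp : ∀ {φ ψ} → φ ⊢ ψ → ψ ⊢ φ → fun φ ≡ fun ψ
        top  : fun ⊤′ ≡ 𝟙
        bot  : fun ⊥′ ≡ 𝟘
        meet : ∀ φ ψ → fun (φ ∧′ ψ) ≡ fun φ ∧ fun ψ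

    record AIdeal : Set where
      field
        fun  : Fm Atom → D
        resp : ∀ {φ ψ} → φ ⊢ ψ → ψ ⊢ φ → fun φ ≡ fun ψ
        bot  : fun ⊥′ ≡ 𝟙
        top  : fun ⊤′ ≡ 𝟘
        join : ∀ φ ψ → fun (φ ∨′ ψ) ≡ fun φ ∧ fun ψ

    open AFilter renaming (fun to _⟨_⟩ᶠ)
    open AIdeal  renaming (fun to _⟨_⟩ⁱ)

    canonicalFrame : APolarity
    canonicalFrame = record
      { X  = AFilter
      ; Y  = AIdeal
      ; I  = λ f i → ⋁ (λ φ → (f ⟨ φ ⟩ᶠ) ⊗ (i ⟨ φ ⟩ⁱ))
      ; R◇ = λ i f → ⋁ (λ φ → (f ⟨ φ ⟩ᶠ) ⊗ (i ⟨ ◇′ φ ⟩ⁱ))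
      ; R□ = λ f i → ⋁ (λ φ → (f ⟨ □′ φ ⟩ᶠ) ⊗ (i ⟨ φ ⟩ⁱ))
      }

    val : Atom → AFilter → D
    val p f = f ⟨ var p ⟩ᶠ

    descr : Atom → AIdeal → D
    descr p i = i ⟨ var p ⟩ⁱ

module Submission where

-- Both equations are instances of one residuated-lattice fact
-- (⋀⇒-attained): a meet  ⋀ₓ (g x ⇒ h x)  equals  c  as soon as
-- g x ⊗ c ≤ h x everywhere and some x₀ has g x₀ = 1 and h x₀ ≤ c.
-- For val(p)↑ at an ideal i we take c = i(p) and x₀ the principal
-- filter of p, whose value is the truth value [ p ⊢ φ ] ∈ A; for
-- descr(p)↓ we take the principal ideal of p dually.  These principal
-- maps are proper exactly because p ⊬ ⊥ and ⊤ ⊬ p, which follows from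
-- soundness of L for the two-element interpretation in Bool.

open import Defs
open import Data.Bool using (Bool; true; false; T) renaming (_∧_ to _∧ᵇ_; _∨_ to _∨ᵇ_)
open import Data.Bool.Properties using (T-∧; T-∨)
open import Data.Empty using (⊥-elim)
open import Data.Product using (_×_; _,_; proj₁; proj₂)
open import Data.Sum using (inj₁; inj₂; [_,_])
open import Function using (_∘_)
open import Function.Bundles using (Equivalence)
open import Relation.Nullary using (¬_)
open import Relation.Binary.PropositionalEquality using (_≡_; refl; trans; cong)

open Equivalence using (to; from)

module TwoValued {Atom : Set} (v : Atom → Bool) where

  ⟦_⟧ : Fm Atom → Bool
  ⟦ ⊥′ ⟧     = false
  ⟦ ⊤′ ⟧     = true
  ⟦ var p ⟧  = v p
  ⟦ φ ∧′ ψ ⟧ = ⟦ φ ⟧ ∧ᵇ ⟦ ψ ⟧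
  ⟦ φ ∨′ ψ ⟧ = ⟦ φ ⟧ ∨ᵇ ⟦ ψ ⟧
  ⟦ □′ φ ⟧   = ⟦ φ ⟧
  ⟦ ◇′ φ ⟧   = ⟦ φ ⟧

  sound : ∀ {φ ψ} → φ ⊢ ψ → T ⟦ φ ⟧ → T ⟦ ψ ⟧
  sound id⊢        t = t
  sound (cut d e)  t = sound e (sound d t)
  sound ⊥⊢         ()
  sound ⊢⊤         _ = _
  sound ∧⊢₁        t = proj₁ (to T-∧ t)
  sound ∧⊢₂        t = proj₂ (to T-∧ t)
  sound (⊢∧ d e)   t = from T-∧ (sound d t , sound e t)
  sound ⊢∨₁        t = from T-∨ (inj₁ t)
  sound ⊢∨₂        t = from T-∨ (inj₂ t)
  sound (∨⊢ d e)   t = [ sound d , sound e ] (to T-∨ t)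
  sound ⊤⊢□⊤       t = t
  sound ◇⊥⊢⊥       t = t
  sound □∧         t = t
  sound ◇∨         t = t
  sound (□mono d)  t = sound d t
  sound (◇mono d)  t = sound d t

atom⊬⊥ : ∀ {Atom : Set} (p : Atom) → ¬ (var p ⊢ ⊥′)
atom⊬⊥ p d = TwoValued.sound (λ _ → true) d _

⊤⊬atom : ∀ {Atom : Set} (p : Atom) → ¬ (⊤′ ⊢ var p)
⊤⊬atom p d = TwoValued.sound (λ _ → false) d _

module ResiduatedLattice (𝐀 : CRL) where
  open CRL 𝐀

  ≤-reflexive : ∀ {a b} → a ≡ b → a ≤ b
  ≤-reflexive refl = ≤-refl

  ⊗-unitʳ : ∀ a → a ⊗ 𝟙 ≡ a
  ⊗-unitʳ a = trans (⊗-comm a 𝟙) (⊗-unitˡ a)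

  ⋀⇒-attained : ∀ {X : Set} (g h : X → D) {c} (x₀ : X) →
                g x₀ ≡ 𝟙 → h x₀ ≤ c → (∀ x → g x ⊗ c ≤ h x) →
                ⋀ (λ x → g x ⇒ h x) ≡ c
  ⋀⇒-attained g h x₀ unit attained bound = ≤-antisym
    (≤-trans (⋀-lb _ x₀)
      (≤-trans (≤-reflexive (trans (cong (_⇒ h x₀) unit) (𝟙⇒ (h x₀)))) attained))
    (⋀-glb _ (λ x → residual₁ (bound x)))

  [_] : Set → D
  [ E ] = ⋁ {E} (λ _ → 𝟙)

  []-intro : ∀ {E : Set} → E → [ E ] ≡ 𝟙
  []-intro e = ≤-antisym (𝟙-top _) (⋁-ub _ e)

  []-empty : ∀ {E : Set} → ¬ E → [ E ] ≡ 𝟘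
  []-empty ¬e = ≤-antisym (⋁-lub _ (⊥-elim ∘ ¬e)) (𝟘-bot _)

  []-map : ∀ {E F : Set} → (E → F) → [ E ] ≤ [ F ]
  []-map f = ⋁-lub _ (λ e → ⋁-ub _ (f e))

  []-cong : ∀ {E F : Set} → (E → F) → (F → E) → [ E ] ≡ [ F ]
  []-cong f g = ≤-antisym ([]-map f) ([]-map g)

  -- Meets of truth values are truth values of products; this is where
  -- frame distributivity is used.
  []-× : ∀ {E F : Set} → [ E ] ∧ [ F ] ≤ [ E × F ]
  []-× {E} {F} = ≤-trans (≤-reflexive (frame-distrib [ E ] (λ (_ : F) → 𝟙)))
    (⋁-lub _ (λ f → ≤-trans (∧-fst _ _) ([]-map (λ e → e , f))))

  []-⊗≤ : ∀ {E : Set} {a c} → (E → a ≤ c) → [ E ] ⊗ a ≤ c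
  []-⊗≤ {a = a} h = ≤-trans (≤-reflexive (⊗-comm _ a))
    (residual₂ (⋁-lub _ (λ e → residual₁ (≤-trans (≤-reflexive (⊗-unitʳ a)) (h e)))))

module CanonicalModel (𝐀 : CRL) (Atom : Set) where
  open CRL 𝐀
  open ResiduatedLattice 𝐀
  open APolarity (canonicalFrame 𝐀 Atom) using (I)
  open AFilter using (meet) renaming (fun to _⟨_⟩ᶠ)
  open AIdeal using (join) renaming (fun to _⟨_⟩ⁱ)

  Filter : Set
  Filter = AFilter 𝐀 Atom

  Ideal : Set
  Ideal = AIdeal 𝐀 Atom

  -- Filters are monotone and ideals antitone along ⊢, since they
  -- respect interderivability and turn ∧ resp. ∨ into meets.
  filter-mono : ∀ (f : Filter) {φ ψ} → φ ⊢ ψ → f ⟨ φ ⟩ᶠ ≤ f ⟨ ψ ⟩ᶠ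
  filter-mono f {φ} {ψ} d = ≤-trans
    (≤-reflexive (trans (AFilter.resp f (⊢∧ id⊢ d) ∧⊢₁) (meet f φ ψ)))
    (∧-snd _ _)

  ideal-anti : ∀ (i : Ideal) {φ ψ} → φ ⊢ ψ → i ⟨ ψ ⟩ⁱ ≤ i ⟨ φ ⟩ⁱ
  ideal-anti i {φ} {ψ} d = ≤-trans
    (≤-reflexive (trans (AIdeal.resp i ⊢∨₂ (∨⊢ d id⊢)) (join i φ ψ)))
    (∧-fst _ _)

  principalFilter : ∀ α → ¬ (α ⊢ ⊥′) → Filter
  principalFilter α α⊬⊥ = record
    { fun  = λ φ → [ α ⊢ φ ]
    ; resp = λ d e → []-cong (λ k → cut k d) (λ k → cut k e)
    ; top  = []-intro ⊢⊤
    ; bot  = []-empty α⊬⊥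
    ; meet = λ φ ψ → ≤-antisym
        (∧-glb ([]-map (λ k → cut k ∧⊢₁)) ([]-map (λ k → cut k ∧⊢₂)))
        (≤-trans []-× ([]-map (λ (k , l) → ⊢∧ k l)))
    }

  principalIdeal : ∀ α → ¬ (⊤′ ⊢ α) → Ideal
  principalIdeal α ⊤⊬α = record
    { fun  = λ φ → [ φ ⊢ α ]
    ; resp = λ d e → []-cong (cut e) (cut d)
    ; bot  = []-intro ⊥⊢
    ; top  = []-empty ⊤⊬α
    ; join = λ φ ψ → ≤-antisym
        (∧-glb ([]-map (cut ⊢∨₁)) ([]-map (cut ⊢∨₂)))
        (≤-trans []-× ([]-map (λ (k , l) → ∨⊢ k l)))
    }

  I-principalFilter≤ : ∀ α (α⊬⊥ : ¬ (α ⊢ ⊥′)) (i : Ideal) →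
                       I (principalFilter α α⊬⊥) i ≤ i ⟨ α ⟩ⁱ
  I-principalFilter≤ α α⊬⊥ i = ⋁-lub _ (λ φ → []-⊗≤ (ideal-anti i))

  I-principalIdeal≤ : ∀ α (⊤⊬α : ¬ (⊤′ ⊢ α)) (f : Filter) →
                      I f (principalIdeal α ⊤⊬α) ≤ f ⟨ α ⟩ᶠ
  I-principalIdeal≤ α ⊤⊬α f = ⋁-lub _ (λ φ →
    ≤-trans (≤-reflexive (⊗-comm _ _)) ([]-⊗≤ (filter-mono f)))

  ⊗≤I : ∀ (f : Filter) (i : Ideal) α → f ⟨ α ⟩ᶠ ⊗ i ⟨ α ⟩ⁱ ≤ I f i
  ⊗≤I f i α = ⋁-ub (λ φ → f ⟨ φ ⟩ᶠ ⊗ i ⟨ φ ⟩ⁱ) α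

  extension↑ : ∀ α → ¬ (α ⊢ ⊥′) → ∀ (i : Ideal) →
               _↑ 𝐀 (canonicalFrame 𝐀 Atom) (λ f → f ⟨ α ⟩ᶠ) i ≡ i ⟨ α ⟩ⁱ
  extension↑ α α⊬⊥ i =
    ⋀⇒-attained (_⟨ α ⟩ᶠ) (λ f → I f i) (principalFilter α α⊬⊥)
      ([]-intro id⊢) (I-principalFilter≤ α α⊬⊥ i) (λ f → ⊗≤I f i α)

  intension↓ : ∀ α → ¬ (⊤′ ⊢ α) → ∀ (f : Filter) →
               _↓ 𝐀 (canonicalFrame 𝐀 Atom) (λ i → i ⟨ α ⟩ⁱ) f ≡ f ⟨ α ⟩ᶠ
  intension↓ α ⊤⊬α f =
    ⋀⇒-attained (_⟨ α ⟩ⁱ) (I f) (principalIdeal α ⊤⊬α)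
      ([]-intro id⊢) (I-principalIdeal≤ α ⊤⊬α f)
      (λ i → ≤-trans (≤-reflexive (⊗-comm _ _)) (⊗≤I f i α))

lemmaA6 : (𝐀 : CRL) (Atom : Set) →
    IsAModel 𝐀 (canonicalFrame 𝐀 Atom) (val 𝐀 Atom) (descr 𝐀 Atom)
lemmaA6 𝐀 Atom p =
    extension↑ (var p) (atom⊬⊥ p)
  , intension↓ (var p) (⊤⊬atom p)
  where open CanonicalModel 𝐀 Atom
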